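{- Let $\Sigma=(\mathrm{PROP},\mathrm{NOM})$ be a finite hybrid signature, $\mathcal{F}\subseteq\{@,\downarrow,\exists,\mathrm{NOM}\}$, $\mathfrak{M},\mathfrak{M}'$ models over $\Sigma$, $\ell,k\in\omega$, $\vec m\in M^k$, $m\in M$, $\vec m'\in M'^k$, $m'\in M'$. The following are equivalent: (i) for every formula $\phi$ of the hybrid language with features from $\mathcal{F}$ of degree at most $\ell$ whose world variables are among $x_1,\dots,x_k$, $\mathfrak{M},\vec m,m\Vdash\phi$ iff $\mathfrak{M}',\vec m',m'\Vdash\phi$; (ii) there is an $\mathcal{F}$-$(k,\ell)$-bisimulation $(Z^k_i)_{i\le\ell}$ from $\mathfrak{M}$ to $\mathfrak{M}'$ such that (a) $(\vec m,m)Z^k_0(\vec m',m')$ and (b) $Z^k_0\subseteq Z^k_1\subseteq\dots\subseteq Z^k_\ell$.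
   Context: Hybrid language. A hybrid signature is $\Sigma=(\mathrm{PROP},\mathrm{NOM})$; finite means both sets finite. World variables $\mathrm{WVAR}=\{x_1,x_2,\dots\}$. For $\mathcal{F}\subseteq\{@,\downarrow,\exists,\mathrm{NOM}\}$, formulas: $\varphi::=\bot\mid p\mid x\mid\neg\varphi\mid\varphi\vee\varphi\mid\Diamond\varphi$, plus nominals $s$ if $\mathrm{NOM}\in\mathcal{F}$, $\downarrow x\,\varphi$ if $\downarrow\in\mathcal{F}$, $@_w\varphi$ if $@\in\mathcal{F}$ ($w\in\mathrm{WVAR}$, or $w\in\mathrm{NOM}$ if $\mathrm{NOM}\in\mathcal{F}$), $\exists x\,\varphi$ if $\exists\in\mathcal{F}$. Models $\mathfrak{M}=(M,R,(s^{\mathfrak{M}})_{s},V)$, $V:\mathrm{PROP}\to\mathcal{P}(M)$. $\mathfrak{M},\vec m,m\Vdash\varphi$ ($\vec m\in M^k$, world variables of $\varphi$ among $x_1,\dots,x_k$) means truth at $m$ under the assignment $x_j\mapsto\vec m(j)$: $p$ iff $m\in V(p)$; $s$ iff $m=s^{\mathfrak{M}}$; $x_j$ iff $m=\vec m(j)$; Boolean as usual; $\Diamond\varphi$ iff true at some $R$-successor; $\downarrow x_j\varphi$ iff $\mathfrak{M},\vec m^{\,j}_m,m\Vdash\varphi$; $@_{x_j}\varphi$ iff $\varphi$ holds at $\vec m(j)$; $@_s\varphi$ iff $\varphi$ holds at $s^{\mathfrak{M}}$; $\exists x_j\varphi$ iff $\mathfrak{M},\vec m^{\,j}_n,m\Vdash\varphi$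 for some $n\in M$. Degree $\mathsf{dg}$: $0$ on atoms; $\mathsf{dg}(\neg\varphi)=\mathsf{dg}(@_w\varphi)=\mathsf{dg}(\varphi)$; $\mathsf{dg}(\varphi\vee\psi)=\max$; $\mathsf{dg}(\Diamond\varphi)=\mathsf{dg}(\downarrow x\,\varphi)=\mathsf{dg}(\exists x\,\varphi)=\mathsf{dg}(\varphi)+1$. Notation: $\vec m(j)$ $j$-th entry; $\vec m^{\,j}_n$ is $\vec m$ with $j$-th entry replaced by $n$. $\mathcal{F}$-$(k,\ell)$-bisimulation from $\mathfrak{M}$ to $\mathfrak{M}'$: a family $(Z^k_i)_{i\le\ell}$, $Z^k_i\subseteq(M^k\times M)\times(M'^k\times M')$, such that for all $i\le\ell$ and $(\vec m,m)Z^k_i(\vec m',m')$: (prop) $m\in V(p)\iff m'\in V'(p)$ for all $p$; (wvar) $\vec m(j)=m\iff\vec m'(j)=m'$ for $j\le k$; (nom, if $\mathrm{NOM}\in\mathcal{F}$) $m=s^{\mathfrak{M}}\iff m'=s^{\mathfrak{M}'}$ for all $s$; (atv, if $@\in\mathcal{F}$) $(\vec m,\vec m(j))Z^k_i(\vec m',\vec m'(j))$ for all $j\le k$; (atn, if $\{@,\mathrm{NOM}\}\subseteq\mathcal{F}$) $(\vec m,s^{\mathfrak{M}})Z^k_i(\vec m',s^{\mathfrak{M}'})$ for all $s$; and for all $1\le i\le\ell$ and $(\vec m,m)Z^k_{i-1}(\vec m',m')$: (forth) each $n$ with $mRn$ has some $n'$ with $m'R'n'$ and $(\vec m,n)Z^k_i(\vec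 m',n')$; (back) symmetrically; (bind, if $\downarrow\in\mathcal{F}$ or $\{\exists,@,\mathrm{NOM}\}\subseteq\mathcal{F}$) $(\vec m^{\,j}_m,m)Z^k_i(\vec m'^{\,j}_{m'},m')$ for all $j\le k$; (ex, if $\exists\in\mathcal{F}$) for all $j\le k$, each $n\in M$ has some $n'\in M'$ with $(\vec m^{\,j}_n,m)Z^k_i(\vec m'^{\,j}_{n'},m')$, and each $n'\in M'$ has some $n\in M$ with the same property. -}

module Defs where

open import Data.Bool using (Bool; T; _∧_; _∨_)
open import Data.Nat using (ℕ; zero; suc; _⊔_; _≤_)
open import Data.Fin using (Fin; inject₁)
import Data.Fin
open import Data.Vec using (Vec; lookup; _[_]≔_)
open import Data.Empty using (⊥)
open import Data.Sum using (_⊎_)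
open import Data.Product using (Σ; _×_)
open import Relation.Nullary using (¬_)
open import Relation.Binary.PropositionalEquality using (_≡_)
open import Function.Bundles using (_⇔_)

-- A finite hybrid signature is given by nP = |PROP| and nN = |NOM|;
-- PROP = Fin nP, NOM = Fin nN.

record Features : Set where
  field
    hasAt   : Bool
    hasDown : Bool
    hasEx   : Bool
    hasNom  : Bool
open Features public

-- Formulas over signature (Fin nP, Fin nN) with features from F whose
-- world variables (free or bound) are among x₁,…,x_k; variable x_{j+1}
-- is represented by j : Fin k.
data Form (nP nN : ℕ) (F : Features) (k : ℕ) : Set where
  fbot  : Form nP nN F k
  fprop : Fin nP → Form nP nN F k
  fvar  : Fin k → Form nP nN F k
  fnom  : T (hasNom F) → Fin nN → Form nP nN F k
  fneg  : Form nP nN F k → Form nP nN F k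
  for   : Form nP nN F k → Form nP nN F k → Form nP nN F k
  fdia  : Form nP nN F k → Form nP nN F k
  fdown : T (hasDown F) → Fin k → Form nP nN F k → Form nP nN F k
  fatv  : T (hasAt F) → Fin k → Form nP nN F k → Form nP nN F k
  fatn  : T (hasAt F) → T (hasNom F) → Fin nN → Form nP nN F k → Form nP nN F k
  fex   : T (hasEx F) → Fin k → Form nP nN F k → Form nP nN F k

dg : ∀ {nP nN F k} → Form nP nN F k → ℕ
dg fbot = 0
dg (fprop _) = 0
dg (fvar _) = 0
dg (fnom _ _) = 0
dg (fneg φ) = dg φ
dg (for φ ψ) = dg φ ⊔ dg ψ
dg (fdia φ) = suc (dg φ)
dg (fdown _ _ φ) = suc (dg φ)
dg (fatv _ _ φ) = dg φ
dg (fatn _ _ _ φ) = dg φ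
dg (fex _ _ φ) = suc (dg φ)

record Model (nP nN : ℕ) : Set₁ where
  field
    W   : Set
    R   : W → W → Set
    nom : Fin nN → W
    V   : Fin nP → W → Set
open Model public

Sat : ∀ {nP nN F k} (𝔐 : Model nP nN) → Vec (W 𝔐) k → W 𝔐 → Form nP nN F k → Set
Sat 𝔐 ms m fbot = ⊥
Sat 𝔐 ms m (fprop p) = V 𝔐 p m
Sat 𝔐 ms m (fvar j) = m ≡ lookup ms j
Sat 𝔐 ms m (fnom _ s) = m ≡ nom 𝔐 s
Sat 𝔐 ms m (fneg φ) = ¬ Sat 𝔐 ms m φ
Sat 𝔐 ms m (for φ ψ) = Sat 𝔐 ms m φ ⊎ Sat 𝔐 ms m ψ
Sat 𝔐 ms m (fdia φ) = Σ (W 𝔐) λ n → R 𝔐 m n × Sat 𝔐 ms n φ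
Sat 𝔐 ms m (fdown _ j φ) = Sat 𝔐 (ms [ j ]≔ m) m φ
Sat 𝔐 ms m (fatv _ j φ) = Sat 𝔐 ms (lookup ms j) φ
Sat 𝔐 ms m (fatn _ _ s φ) = Sat 𝔐 ms (nom 𝔐 s) φ
Sat 𝔐 ms m (fex _ j φ) = Σ (W 𝔐) λ n → Sat 𝔐 (ms [ j ]≔ n) m φ

Rel : ∀ {nP nN} (k : ℕ) (𝔐 𝔐' : Model nP nN) → Set₁
Rel k 𝔐 𝔐' = Vec (W 𝔐) k → W 𝔐 → Vec (W 𝔐') k → W 𝔐' → Set

-- The step conditions for 1 ≤ i ≤ ℓ are stated for i : Fin ℓ,
-- relating Z (inject₁ i) (the level i-1) to Z (Data.Fin.suc i) (the level i).
record IsBisim {nP nN} (F : Features) (k ℓ : ℕ) (𝔐 𝔐' : Model nP nN)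
               (Z : Fin (suc ℓ) → Rel k 𝔐 𝔐') : Set where
  field
    prop  : ∀ i ms m ms' m' → Z i ms m ms' m' →
            ∀ (p : Fin nP) → V 𝔐 p m ⇔ V 𝔐' p m'
    wvar  : ∀ i ms m ms' m' → Z i ms m ms' m' →
            ∀ (j : Fin k) → (lookup ms j ≡ m) ⇔ (lookup ms' j ≡ m')
    noms  : T (hasNom F) → ∀ i ms m ms' m' → Z i ms m ms' m' →
            ∀ (s : Fin nN) → (m ≡ nom 𝔐 s) ⇔ (m' ≡ nom 𝔐' s)
    atv   : T (hasAt F) → ∀ i ms m ms' m' → Z i ms m ms' m' →
            ∀ (j : Fin k) → Z i ms (lookup ms j) ms' (lookup ms' j)
    atn   : T (hasAt F ∧ hasNom F) → ∀ i ms m ms' m' → Z i ms m ms' m' →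
            ∀ (s : Fin nN) → Z i ms (nom 𝔐 s) ms' (nom 𝔐' s)
    forth : ∀ (i : Fin ℓ) ms m ms' m' → Z (inject₁ i) ms m ms' m' →
            ∀ n → R 𝔐 m n → Σ (W 𝔐') λ n' → R 𝔐' m' n' × Z (Data.Fin.suc i) ms n ms' n'
    back  : ∀ (i : Fin ℓ) ms m ms' m' → Z (inject₁ i) ms m ms' m' →
            ∀ n' → R 𝔐' m' n' → Σ (W 𝔐) λ n → R 𝔐 m n × Z (Data.Fin.suc i) ms n ms' n'
    bind  : T (hasDown F ∨ (hasEx F ∧ hasAt F ∧ hasNom F)) →
            ∀ (i : Fin ℓ) ms m ms' m' → Z (inject₁ i) ms m ms' m' →
            ∀ (j : Fin k) → Z (Data.Fin.suc i) (ms [ j ]≔ m) m (ms' [ j ]≔ m') m'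
    exf   : T (hasEx F) →
            ∀ (i : Fin ℓ) ms m ms' m' → Z (inject₁ i) ms m ms' m' →
            ∀ (j : Fin k) (n : W 𝔐) →
            Σ (W 𝔐') λ n' → Z (Data.Fin.suc i) (ms [ j ]≔ n) m (ms' [ j ]≔ n') m'
    exb   : T (hasEx F) →
            ∀ (i : Fin ℓ) ms m ms' m' → Z (inject₁ i) ms m ms' m' →
            ∀ (j : Fin k) (n' : W 𝔐') →
            Σ (W 𝔐) λ n → Z (Data.Fin.suc i) (ms [ j ]≔ n) m (ms' [ j ]≔ n') m'

FormEquiv : ∀ {nP nN} (F : Features) (k ℓ : ℕ) (𝔐 𝔐' : Model nP nN) →
            Vec (W 𝔐) k → W 𝔐 → Vec (W 𝔐') k → W 𝔐' → Set
FormEquiv {nP} {nN} F k ℓ 𝔐 𝔐' ms m ms' m' =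
  ∀ (φ : Form nP nN F k) → dg φ ≤ ℓ → Sat 𝔐 ms m φ ⇔ Sat 𝔐' ms' m' φ

BisimCond : ∀ {nP nN} (F : Features) (k ℓ : ℕ) (𝔐 𝔐' : Model nP nN) →
            Vec (W 𝔐) k → W 𝔐 → Vec (W 𝔐') k → W 𝔐' → Set₁
BisimCond F k ℓ 𝔐 𝔐' ms m ms' m' =
  Σ (Fin (suc ℓ) → Rel k 𝔐 𝔐') λ Z →
    IsBisim F k ℓ 𝔐 𝔐' Z
    × Z Data.Fin.zero ms m ms' m'
    × (∀ (i : Fin ℓ) xs x xs' x' → Z (inject₁ i) xs x xs' x' → Z (Data.Fin.suc i) xs x xs' x')

-- Soundness is an induction on formulas: Z i preserves every formula of degree at most ℓ ∸ i,
-- the back-and-forth clauses paying for one modality, ↓ or ∃ each.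
--
-- For completeness take Z i to be agreement on all formulas of degree ≤ ℓ ∸ i. Because the
-- signature and the set of variables are finite, there is a finite list of formulas of degree ≤ d
-- (tests d) such that agreement on it, at the current world and at the worlds named by variables
-- and nominals, already gives agreement on every formula of degree ≤ d. The conjunction of the
-- literals of this list (closed under @) true at a point is then a characteristic formula of the
-- point's degree-d type, and putting it under ◇, ↓ or ∃ produces the witnesses demanded by the
-- forth, back, bind and ex clauses. Excluded middle is used to choose these literals and to read
-- conjunctions back from their encoding by ¬ and ∨.

module Submission where

open import Defs
open import Level using (0ℓ)
open import Axiom.ExcludedMiddle using (ExcludedMiddle)
open import Axiom.DoubleNegationElimination using (em⇒dne)
open import Data.Bool using (Bool; true; false; T; _∧_; _∨_)
open import Data.Bool.Properties using (T-∧; T-∨)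
open import Data.Unit using (tt)
open import Data.Empty using (⊥-elim)
open import Data.Nat using (ℕ; zero; suc; _≤_; _∸_; z≤n; s≤s)
open import Data.Nat.Properties using (⊔-lub; m⊔n≤o⇒m≤o; m⊔n≤o⇒n≤o; m≤n⇒m≤1+n)
open import Data.Fin using (Fin; inject₁; toℕ) renaming (zero to fzero; suc to fsuc)
open import Data.Vec using (Vec; lookup; _[_]≔_)
open import Data.Vec.Properties using (lookup∘update)
open import Data.List using (List; []; _∷_; [_]; _++_; map; concatMap; foldr; allFin)
open import Data.List.Membership.Propositional using (_∈_; lose)
open import Data.List.Membership.Propositional.Properties
  using (∈-++⁺ˡ; ∈-++⁺ʳ; ∈-map⁺; ∈-concatMap⁺; ∈-allFin)
open import Data.List.Relation.Unary.Any using (here; there)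
open import Data.List.Relation.Unary.All as All using (All; []; _∷_)
open import Data.List.Relation.Unary.All.Properties using (++⁺; map⁺; map⁻; concat⁺)
open import Data.Sum using (inj₁; inj₂)
open import Data.Sum.Function.Propositional using (_⊎-⇔_)
open import Data.Product using (∃-syntax; _×_; _,_; proj₁; proj₂)
open import Function using (_∘_; const)
open import Function.Bundles using (_⇔_; mk⇔; Equivalence)
import Function.Properties.Equivalence as ⇔
open import Function.Related.TypeIsomorphisms using (¬-cong-⇔)
open import Relation.Nullary using (¬_; Dec; yes; no)
open import Relation.Binary.PropositionalEquality using (_≡_; refl; sym; trans; subst)

open Equivalence using (to; from)

module _ {A : Set} where

  whenT : (b : Bool) → (T b → List A) → List A
  whenT true  xs = xs tt
  whenT false xs = []

  ∈-whenT : ∀ b {xs : T b → List A} (h : T b) {x} → x ∈ xs h → x ∈ whenT b xs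
  ∈-whenT true h x∈ = x∈

  All-whenT : ∀ {P : A → Set} b {xs : T b → List A} → (∀ h → All P (xs h)) → All P (whenT b xs)
  All-whenT true  all = all tt
  All-whenT false all = []

  ∈-concatMap⁺′ : ∀ {B : Set} (f : B → List A) {x xs y} → x ∈ xs → y ∈ f x → y ∈ concatMap f xs
  ∈-concatMap⁺′ f x∈ y∈ = ∈-concatMap⁺ f (lose x∈ y∈)

  All-concatMap⁺ : ∀ {B : Set} {P : A → Set} (f : B → List A) {xs} →
                   All (All P ∘ f) xs → All P (concatMap f xs)
  All-concatMap⁺ f = concat⁺ ∘ map⁺

≡-flip⇔ : ∀ {A B : Set} {a b : A} {c d : B} → (a ≡ b) ⇔ (c ≡ d) → (b ≡ a) ⇔ (d ≡ c)
≡-flip⇔ e = mk⇔ (sym ∘ to e ∘ sym) (sym ∘ from e ∘ sym)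

∸-inject₁ : ∀ {ℓ} (i : Fin ℓ) → ℓ ∸ toℕ (inject₁ i) ≡ suc (ℓ ∸ toℕ (fsuc i))
∸-inject₁ {suc ℓ} fzero    = refl
∸-inject₁ {suc ℓ} (fsuc i) = ∸-inject₁ i

∸-toℕ-pos⇒inject₁ : ∀ ℓ (i : Fin (suc ℓ)) {d} → suc d ≤ ℓ ∸ toℕ i →
                    ∃[ i′ ] i ≡ inject₁ i′ × d ≤ ℓ ∸ toℕ (fsuc i′)
∸-toℕ-pos⇒inject₁ (suc ℓ) fzero    (s≤s d≤) = fzero , refl , d≤
∸-toℕ-pos⇒inject₁ (suc ℓ) (fsuc i) d<       with ∸-toℕ-pos⇒inject₁ ℓ i d<
... | i′ , refl , d≤ = fsuc i′ , refl , d≤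

module Soundness {nP nN : ℕ} {F : Features} {k ℓ : ℕ} {𝔐 𝔐′ : Model nP nN}
                 {Z : Fin (suc ℓ) → Rel k 𝔐 𝔐′} (isBisim : IsBisim F k ℓ 𝔐 𝔐′ Z) where

  open IsBisim isBisim

  bisim⇒equiv : ∀ i (φ : Form nP nN F k) → dg φ ≤ ℓ ∸ toℕ i →
                ∀ {ms m ms′ m′} → Z i ms m ms′ m′ → Sat 𝔐 ms m φ ⇔ Sat 𝔐′ ms′ m′ φ
  bisim⇒equiv i fbot       _ z = ⇔.refl
  bisim⇒equiv i (fprop p)  _ z = prop i _ _ _ _ z p
  bisim⇒equiv i (fvar j)   _ z = ≡-flip⇔ (wvar i _ _ _ _ z j)
  bisim⇒equiv i (fnom h s) _ z = noms h i _ _ _ _ z s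
  bisim⇒equiv i (fneg φ)   p z = ¬-cong-⇔ (bisim⇒equiv i φ p z)
  bisim⇒equiv i (for φ ψ)  p z =
        bisim⇒equiv i φ (m⊔n≤o⇒m≤o (dg φ) (dg ψ) p) z
    ⊎-⇔ bisim⇒equiv i ψ (m⊔n≤o⇒n≤o (dg φ) (dg ψ) p) z
  bisim⇒equiv i (fatv h j φ) p z = bisim⇒equiv i φ p (atv h i _ _ _ _ z j)
  bisim⇒equiv i (fatn h h′ s φ) p z = bisim⇒equiv i φ p (atn (from T-∧ (h , h′)) i _ _ _ _ z s)
  bisim⇒equiv i (fdia φ) p z with ∸-toℕ-pos⇒inject₁ ℓ i p
  ... | i′ , refl , q = mk⇔
    (λ (n , r , s) → let n′ , r′ , z′ = forth i′ _ _ _ _ z n r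
                     in n′ , r′ , to (bisim⇒equiv (fsuc i′) φ q z′) s)
    (λ (n′ , r′ , s) → let n , r , z′ = back i′ _ _ _ _ z n′ r′
                       in n , r , from (bisim⇒equiv (fsuc i′) φ q z′) s)
  bisim⇒equiv i (fdown h j φ) p z with ∸-toℕ-pos⇒inject₁ ℓ i p
  ... | i′ , refl , q = bisim⇒equiv (fsuc i′) φ q (bind (from T-∨ (inj₁ h)) i′ _ _ _ _ z j)
  bisim⇒equiv i (fex h j φ) p z with ∸-toℕ-pos⇒inject₁ ℓ i p
  ... | i′ , refl , q = mk⇔
    (λ (n , s) → let n′ , z′ = exf h i′ _ _ _ _ z j n
                 in n′ , to (bisim⇒equiv (fsuc i′) φ q z′) s)
    (λ (n′ , s) → let n , z′ = exb h i′ _ _ _ _ z j n′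
                  in n , from (bisim⇒equiv (fsuc i′) φ q z′) s)

module Characteristic (em : ExcludedMiddle 0ℓ) (nP nN : ℕ) (F : Features) (k : ℕ) where

  Fm : Set
  Fm = Form nP nN F k

  Mdl : Set₁
  Mdl = Model nP nN

  dne : {P : Set} → ¬ ¬ P → P
  dne = em⇒dne em

  ⊤ᶠ : Fm
  ⊤ᶠ = fneg fbot

  _∧ᶠ_ : Fm → Fm → Fm
  φ ∧ᶠ ψ = fneg (for (fneg φ) (fneg ψ))

  ⋀ : List Fm → Fm
  ⋀ = foldr _∧ᶠ_ ⊤ᶠ

  module _ {𝔐 : Mdl} {ms : Vec (W 𝔐) k} {m : W 𝔐} where

    ∧ᶠ-intro : ∀ φ ψ → Sat 𝔐 ms m φ → Sat 𝔐 ms m ψ → Sat 𝔐 ms m (φ ∧ᶠ ψ)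
    ∧ᶠ-intro φ ψ a b (inj₁ ¬a) = ¬a a
    ∧ᶠ-intro φ ψ a b (inj₂ ¬b) = ¬b b

    ∧ᶠ-elimˡ : ∀ φ ψ → Sat 𝔐 ms m (φ ∧ᶠ ψ) → Sat 𝔐 ms m φ
    ∧ᶠ-elimˡ φ ψ c = dne (c ∘ inj₁)

    ∧ᶠ-elimʳ : ∀ φ ψ → Sat 𝔐 ms m (φ ∧ᶠ ψ) → Sat 𝔐 ms m ψ
    ∧ᶠ-elimʳ φ ψ c = dne (c ∘ inj₂)

    ⋀-intro : ∀ {L} → All (Sat 𝔐 ms m) L → Sat 𝔐 ms m (⋀ L)
    ⋀-intro []       = λ ()
    ⋀-intro {φ ∷ L} (a ∷ as) = ∧ᶠ-intro φ (⋀ L) a (⋀-intro as)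

    ⋀-elim : ∀ L → Sat 𝔐 ms m (⋀ L) → All (Sat 𝔐 ms m) L
    ⋀-elim []      _ = []
    ⋀-elim (φ ∷ L) c = ∧ᶠ-elimˡ φ (⋀ L) c ∷ ⋀-elim L (∧ᶠ-elimʳ φ (⋀ L) c)

  DgAtMost : ℕ → Fm → Set
  DgAtMost d φ = dg φ ≤ d

  ⋀-dg : ∀ {d L} → All (DgAtMost d) L → dg (⋀ L) ≤ d
  ⋀-dg []       = z≤n
  ⋀-dg (b ∷ bs) = ⊔-lub b (⋀-dg bs)

  signed : {P : Set} → Dec P → Fm → Fm
  signed (yes _) φ = φ
  signed (no _)  φ = fneg φ

  signPatterns : List Fm → List (List Fm)
  signPatterns []      = [ [] ]
  signPatterns (φ ∷ A) = map (φ ∷_) (signPatterns A) ++ map (fneg φ ∷_) (signPatterns A)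

  signed∈signPatterns : {P : Fm → Set} (P? : ∀ φ → Dec (P φ)) (A : List Fm) →
                        map (λ φ → signed (P? φ) φ) A ∈ signPatterns A
  signed∈signPatterns P? []      = here refl
  signed∈signPatterns P? (φ ∷ A) with P? φ
  ... | yes _ = ∈-++⁺ˡ (∈-map⁺ (φ ∷_) (signed∈signPatterns P? A))
  ... | no _  = ∈-++⁺ʳ _ (∈-map⁺ (fneg φ ∷_) (signed∈signPatterns P? A))

  signPatterns-dg : ∀ {d A} → All (DgAtMost d) A → All (All (DgAtMost d)) (signPatterns A)
  signPatterns-dg []       = [] ∷ []
  signPatterns-dg (b ∷ bs) =
    ++⁺ (map⁺ (All.map (b ∷_) (signPatterns-dg bs))) (map⁺ (All.map (b ∷_) (signPatterns-dg bs)))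

  profile : (𝔐 : Mdl) → Vec (W 𝔐) k → W 𝔐 → List Fm → List Fm
  profile 𝔐 ms m = map (λ φ → signed (em {Sat 𝔐 ms m φ}) φ)

  module _ {𝔐 : Mdl} {ms : Vec (W 𝔐) k} {m : W 𝔐} where

    signed-sat : ∀ {φ} (d : Dec (Sat 𝔐 ms m φ)) → Sat 𝔐 ms m (signed d φ)
    signed-sat (yes a) = a
    signed-sat (no ¬a) = ¬a

    profile-sat : ∀ A → All (Sat 𝔐 ms m) (profile 𝔐 ms m A)
    profile-sat A = map⁺ (All.universal (λ _ → signed-sat em) A)

  Agree : List Fm → (𝔐 𝔐′ : Mdl) → Vec (W 𝔐) k → W 𝔐 → Vec (W 𝔐′) k → W 𝔐′ → Set
  Agree A 𝔐 𝔐′ ms m ms′ m′ = ∀ {φ} → φ ∈ A → Sat 𝔐 ms m φ ⇔ Sat 𝔐′ ms′ m′ φ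

  module _ {𝔐 𝔐′ : Mdl} {ms : Vec (W 𝔐) k} {m : W 𝔐} {ms′ : Vec (W 𝔐′) k} {m′ : W 𝔐′} where

    signed-agree : ∀ {φ} (d : Dec (Sat 𝔐 ms m φ)) → Sat 𝔐′ ms′ m′ (signed d φ) →
                   Sat 𝔐 ms m φ ⇔ Sat 𝔐′ ms′ m′ φ
    signed-agree (yes a) s = mk⇔ (const s) (const a)
    signed-agree (no ¬a) s = mk⇔ (⊥-elim ∘ ¬a) (⊥-elim ∘ s)

    profile⇒agree : ∀ A → All (Sat 𝔐′ ms′ m′) (profile 𝔐 ms m A) → Agree A 𝔐 𝔐′ ms m ms′ m′
    profile⇒agree A s φ∈ = signed-agree em (All.lookup (map⁻ s) φ∈)

  record AgreeNamed (A : List Fm) (𝔐 𝔐′ : Mdl) (ms : Vec (W 𝔐) k) (m : W 𝔐)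
                    (ms′ : Vec (W 𝔐′) k) (m′ : W 𝔐′) : Set where
    field
      atCurrent : Agree A 𝔐 𝔐′ ms m ms′ m′
      atVar     : T (hasAt F) → ∀ j → Agree A 𝔐 𝔐′ ms (lookup ms j) ms′ (lookup ms′ j)
      atNom     : T (hasAt F) → T (hasNom F) → ∀ s → Agree A 𝔐 𝔐′ ms (nom 𝔐 s) ms′ (nom 𝔐′ s)
  open AgreeNamed

  AgreeNamed-sym : ∀ {A 𝔐 𝔐′ ms m ms′ m′} → AgreeNamed A 𝔐 𝔐′ ms m ms′ m′ →
                   AgreeNamed A 𝔐′ 𝔐 ms′ m′ ms m
  AgreeNamed-sym ag = record
    { atCurrent = ⇔.sym ∘ atCurrent ag
    ; atVar     = λ h j → ⇔.sym ∘ atVar ag h j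
    ; atNom     = λ h h′ s → ⇔.sym ∘ atNom ag h h′ s
    }

  AgreeNamed-moveTo : ∀ {A 𝔐 𝔐′ ms m ms′ m′ n n′} → AgreeNamed A 𝔐 𝔐′ ms m ms′ m′ →
                      Agree A 𝔐 𝔐′ ms n ms′ n′ → AgreeNamed A 𝔐 𝔐′ ms n ms′ n′
  AgreeNamed-moveTo ag a = record { atCurrent = a ; atVar = atVar ag ; atNom = atNom ag }

  atShifts : List Fm → List Fm
  atShifts A = whenT (hasAt F) λ h →
    concatMap (λ j → map (fatv h j) A) (allFin k)
    ++ whenT (hasNom F) (λ h′ → concatMap (λ s → map (fatn h h′ s) A) (allFin nN))

  atClosure : List Fm → List Fm
  atClosure A = A ++ atShifts A

  atClosure-dg : ∀ {d A} → All (DgAtMost d) A → All (DgAtMost d) (atClosure A)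
  atClosure-dg bs = ++⁺ bs (All-whenT (hasAt F) λ h →
    ++⁺ (All-concatMap⁺ (λ j → map (fatv h j) _) (All.universal (λ _ → map⁺ bs) (allFin k)))
        (All-whenT (hasNom F) λ h′ →
          All-concatMap⁺ (λ s → map (fatn h h′ s) _) (All.universal (λ _ → map⁺ bs) (allFin nN))))

  atClosure⇒agreeNamed : ∀ A {𝔐 𝔐′ ms m ms′ m′} →
                         Agree (atClosure A) 𝔐 𝔐′ ms m ms′ m′ → AgreeNamed A 𝔐 𝔐′ ms m ms′ m′
  atClosure⇒agreeNamed A ag = record
    { atCurrent = ag ∘ ∈-++⁺ˡ
    ; atVar     = λ h j → ag ∘ ∈-++⁺ʳ A ∘ ∈-whenT (hasAt F) h ∘ ∈-++⁺ˡ
                            ∘ ∈-concatMap⁺′ _ (∈-allFin j) ∘ ∈-map⁺ (fatv h j)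
    ; atNom     = λ h h′ s → ag ∘ ∈-++⁺ʳ A ∘ ∈-whenT (hasAt F) h ∘ ∈-++⁺ʳ _ ∘ ∈-whenT (hasNom F) h′
                               ∘ ∈-concatMap⁺′ _ (∈-allFin s) ∘ ∈-map⁺ (fatn h h′ s)
    }

  atoms : List Fm
  atoms = map fprop (allFin nP) ++ map fvar (allFin k)
       ++ whenT (hasNom F) (λ h → map (fnom h) (allFin nN))

  atoms-dg : ∀ {d} → All (DgAtMost d) atoms
  atoms-dg = ++⁺ (map⁺ (All.universal (const z≤n) (allFin nP)))
           (++⁺ (map⁺ (All.universal (const z≤n) (allFin k)))
                (All-whenT (hasNom F) λ h → map⁺ (All.universal (const z≤n) (allFin nN))))

  fprop∈atoms : ∀ p → fprop p ∈ atoms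
  fprop∈atoms p = ∈-++⁺ˡ (∈-map⁺ fprop (∈-allFin p))

  fvar∈atoms : ∀ j → fvar j ∈ atoms
  fvar∈atoms j = ∈-++⁺ʳ (map fprop (allFin nP)) (∈-++⁺ˡ (∈-map⁺ fvar (∈-allFin j)))

  fnom∈atoms : ∀ h s → fnom h s ∈ atoms
  fnom∈atoms h s = ∈-++⁺ʳ (map fprop (allFin nP)) (∈-++⁺ʳ (map fvar (allFin k))
    (∈-whenT (hasNom F) {λ h → map (fnom h) (allFin nN)} h (∈-map⁺ (fnom h) (∈-allFin s))))

  modalTests : Fm → List Fm
  modalTests χ = fdia χ ∷ whenT (hasDown F) (λ h → map (λ j → fdown h j χ) (allFin k))
                        ++ whenT (hasEx F) (λ h → map (λ j → fex h j χ) (allFin k))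

  modalTests-dg : ∀ {d χ} → dg χ ≤ d → All (DgAtMost (suc d)) (modalTests χ)
  modalTests-dg b = s≤s b ∷ ++⁺ (All-whenT (hasDown F) λ _ → map⁺ (All.universal (const (s≤s b)) _))
                                (All-whenT (hasEx F) λ _ → map⁺ (All.universal (const (s≤s b)) _))

  fdown∈modalTests : ∀ h j χ → fdown h j χ ∈ modalTests χ
  fdown∈modalTests h j χ = there (∈-++⁺ˡ (∈-whenT (hasDown F) h (∈-map⁺ _ (∈-allFin j))))

  fex∈modalTests : ∀ h j χ → fex h j χ ∈ modalTests χ
  fex∈modalTests h j χ = there (∈-++⁺ʳ _ (∈-whenT (hasEx F) h (∈-map⁺ _ (∈-allFin j))))

  -- Finite because PROP, NOM and the variables are: a sign pattern over atClosure (tests d) is a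
  -- candidate degree-d type of a successor or of a rebound point.
  tests : ℕ → List Fm
  tests zero    = atoms
  tests (suc d) = tests d ++ concatMap (modalTests ∘ ⋀) (signPatterns (atClosure (tests d)))

  tests-dg : ∀ d → All (DgAtMost d) (tests d)
  tests-dg zero    = atoms-dg
  tests-dg (suc d) = ++⁺ (All.map m≤n⇒m≤1+n (tests-dg d))
    (All-concatMap⁺ (modalTests ∘ ⋀)
      (All.map (modalTests-dg ∘ ⋀-dg) (signPatterns-dg (atClosure-dg (tests-dg d)))))

  atoms⊆tests : ∀ d {φ} → φ ∈ atoms → φ ∈ tests d
  atoms⊆tests zero    = λ φ∈ → φ∈
  atoms⊆tests (suc d) = ∈-++⁺ˡ ∘ atoms⊆tests d

  char : ℕ → (𝔐 : Mdl) → Vec (W 𝔐) k → W 𝔐 → Fm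
  char d 𝔐 ms m = ⋀ (profile 𝔐 ms m (atClosure (tests d)))

  module _ (d : ℕ) (𝔐 : Mdl) (ms : Vec (W 𝔐) k) (m : W 𝔐) where

    char-sat : Sat 𝔐 ms m (char d 𝔐 ms m)
    char-sat = ⋀-intro {L = profile 𝔐 ms m (atClosure (tests d))} (profile-sat _)

    char-dg : dg (char d 𝔐 ms m) ≤ d
    char-dg = ⋀-dg (All.lookup (signPatterns-dg (atClosure-dg (tests-dg d)))
                               (signed∈signPatterns (λ φ → em) (atClosure (tests d))))

    modalTests-char⊆tests : ∀ {ψ} → ψ ∈ modalTests (char d 𝔐 ms m) → ψ ∈ tests (suc d)
    modalTests-char⊆tests =
      ∈-++⁺ʳ (tests d)
      ∘ ∈-concatMap⁺′ (modalTests ∘ ⋀) (signed∈signPatterns (λ φ → em) (atClosure (tests d)))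

    char⇒agreeNamed : ∀ {𝔐′ ms′ m′} → Sat 𝔐′ ms′ m′ (char d 𝔐 ms m) →
                      AgreeNamed (tests d) 𝔐 𝔐′ ms m ms′ m′
    char⇒agreeNamed c =
      atClosure⇒agreeNamed (tests d) (profile⇒agree (atClosure (tests d)) (⋀-elim _ c))

  tests-determine : ∀ d (φ : Fm) → dg φ ≤ d → ∀ {𝔐 𝔐′ ms m ms′ m′} →
                    AgreeNamed (tests d) 𝔐 𝔐′ ms m ms′ m′ → Sat 𝔐 ms m φ → Sat 𝔐′ ms′ m′ φ
  tests-determine d fbot _ _ ()
  tests-determine d (fprop p)  _ ag = to (atCurrent ag (atoms⊆tests d (fprop∈atoms p)))
  tests-determine d (fvar j)   _ ag = to (atCurrent ag (atoms⊆tests d (fvar∈atoms j)))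
  tests-determine d (fnom h s) _ ag = to (atCurrent ag (atoms⊆tests d (fnom∈atoms h s)))
  tests-determine d (fneg φ) p ag ¬s = ¬s ∘ tests-determine d φ p (AgreeNamed-sym ag)
  tests-determine d (for φ ψ) p ag (inj₁ s) =
    inj₁ (tests-determine d φ (m⊔n≤o⇒m≤o (dg φ) (dg ψ) p) ag s)
  tests-determine d (for φ ψ) p ag (inj₂ s) =
    inj₂ (tests-determine d ψ (m⊔n≤o⇒n≤o (dg φ) (dg ψ) p) ag s)
  tests-determine d (fatv h j φ) p ag =
    tests-determine d φ p (AgreeNamed-moveTo ag (atVar ag h j))
  tests-determine d (fatn h h′ s φ) p ag =
    tests-determine d φ p (AgreeNamed-moveTo ag (atNom ag h h′ s))
  tests-determine (suc d) (fdia φ) (s≤s p) {𝔐} {ms = ms} ag (n , r , s) =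
    let n′ , r′ , c = to (atCurrent ag (modalTests-char⊆tests d 𝔐 ms n (here refl)))
                         (n , r , char-sat d 𝔐 ms n)
    in n′ , r′ , tests-determine d φ p (char⇒agreeNamed d 𝔐 ms n c) s
  tests-determine (suc d) (fdown h j φ) (s≤s p) {𝔐} {ms = ms} {m} ag s =
    let c = to (atCurrent ag (modalTests-char⊆tests d 𝔐 _ m (fdown∈modalTests h j _)))
               (char-sat d 𝔐 (ms [ j ]≔ m) m)
    in tests-determine d φ p (char⇒agreeNamed d 𝔐 _ m c) s
  tests-determine (suc d) (fex h j φ) (s≤s p) {𝔐} {ms = ms} {m} ag (n , s) =
    let n′ , c = to (atCurrent ag (modalTests-char⊆tests d 𝔐 _ m (fex∈modalTests h j _)))
                    (n , char-sat d 𝔐 (ms [ j ]≔ n) m)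
    in n′ , tests-determine d φ p (char⇒agreeNamed d 𝔐 _ m c) s

  module _ {𝔐 𝔐′ : Mdl} where

    char⇒equiv : ∀ d {ms m ms′ m′} → Sat 𝔐′ ms′ m′ (char d 𝔐 ms m) →
                 FormEquiv F k d 𝔐 𝔐′ ms m ms′ m′
    char⇒equiv d {ms} {m} c φ p =
      mk⇔ (tests-determine d φ p ag) (tests-determine d φ p (AgreeNamed-sym ag))
      where ag = char⇒agreeNamed d 𝔐 ms m c

    FormEquiv-sym : ∀ {d ms m ms′ m′} → FormEquiv F k d 𝔐 𝔐′ ms m ms′ m′ →
                    FormEquiv F k d 𝔐′ 𝔐 ms′ m′ ms m
    FormEquiv-sym eq φ p = ⇔.sym (eq φ p)

  module _ {d : ℕ} {𝔐 𝔐′ : Mdl} {ms : Vec (W 𝔐) k} {m : W 𝔐} {ms′ : Vec (W 𝔐′) k} {m′ : W 𝔐′}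
           (eq : FormEquiv F k (suc d) 𝔐 𝔐′ ms m ms′ m′) where

    FormEquiv-forth : ∀ {n} → R 𝔐 m n → ∃[ n′ ] R 𝔐′ m′ n′ × FormEquiv F k d 𝔐 𝔐′ ms n ms′ n′
    FormEquiv-forth {n} r =
      let n′ , r′ , c = to (eq (fdia (char d 𝔐 ms n)) (s≤s (char-dg d 𝔐 ms n)))
                           (n , r , char-sat d 𝔐 ms n)
      in n′ , r′ , char⇒equiv d c

    FormEquiv-exf : T (hasEx F) → ∀ j n →
                    ∃[ n′ ] FormEquiv F k d 𝔐 𝔐′ (ms [ j ]≔ n) m (ms′ [ j ]≔ n′) m′
    FormEquiv-exf h j n =
      let n′ , c = to (eq (fex h j (char d 𝔐 _ m)) (s≤s (char-dg d 𝔐 _ m))) (n , char-sat d 𝔐 _ m)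
      in n′ , char⇒equiv d c

    FormEquiv-bind : T (hasDown F ∨ (hasEx F ∧ hasAt F ∧ hasNom F)) →
                     ∀ j → FormEquiv F k d 𝔐 𝔐′ (ms [ j ]≔ m) m (ms′ [ j ]≔ m′) m′
    FormEquiv-bind h j with to T-∨ h
    ... | inj₁ h↓ =
      char⇒equiv d (to (eq (fdown h↓ j (char d 𝔐 _ m)) (s≤s (char-dg d 𝔐 _ m))) (char-sat d 𝔐 _ m))
    ... | inj₂ h∃ =
      -- ∃ xⱼ (xⱼ ∧ χ) forces the witness to be the current world, so it simulates ↓ xⱼ χ.
      let n′ , c = to (eq (fex h∃′ j (fvar j ∧ᶠ χ)) (s≤s (char-dg d 𝔐 _ m)))
                      (m , ∧ᶠ-intro (fvar j) χ (sym (lookup∘update j ms m)) (char-sat d 𝔐 _ m))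
          m′≡n′ = trans (∧ᶠ-elimˡ (fvar j) χ c) (lookup∘update j ms′ n′)
      in char⇒equiv d (subst (λ x → Sat 𝔐′ (ms′ [ j ]≔ x) m′ χ) (sym m′≡n′) (∧ᶠ-elimʳ (fvar j) χ c))
      where χ = char d 𝔐 (ms [ j ]≔ m) m
            h∃′ = proj₁ (to T-∧ h∃)

  equiv⇒bisim : ∀ ℓ {𝔐 𝔐′ ms m ms′ m′} → FormEquiv F k ℓ 𝔐 𝔐′ ms m ms′ m′ →
                BisimCond F k ℓ 𝔐 𝔐′ ms m ms′ m′
  equiv⇒bisim ℓ {𝔐} {𝔐′} eq = Z , isBisim , eq , λ i _ _ _ _ z φ p → predecessor i z φ (m≤n⇒m≤1+n p)
    where
    Z : Fin (suc ℓ) → Rel k 𝔐 𝔐′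
    Z i = FormEquiv F k (ℓ ∸ toℕ i) 𝔐 𝔐′

    predecessor : ∀ i {ms m ms′ m′} → Z (inject₁ i) ms m ms′ m′ →
                  FormEquiv F k (suc (ℓ ∸ toℕ (fsuc i))) 𝔐 𝔐′ ms m ms′ m′
    predecessor i {ms} {m} {ms′} {m′} =
      subst (λ d → FormEquiv F k d 𝔐 𝔐′ ms m ms′ m′) (∸-inject₁ i)

    isBisim : IsBisim F k ℓ 𝔐 𝔐′ Z
    isBisim = record
      { prop  = λ _ _ _ _ _ z p → z (fprop p) z≤n
      ; wvar  = λ _ _ _ _ _ z j → ≡-flip⇔ (z (fvar j) z≤n)
      ; noms  = λ h _ _ _ _ _ z s → z (fnom h s) z≤n
      ; atv   = λ h _ _ _ _ _ z j φ p → z (fatv h j φ) p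
      ; atn   = λ h _ _ _ _ _ z s φ p → z (fatn (proj₁ (to T-∧ h)) (proj₂ (to T-∧ h)) s φ) p
      ; forth = λ i _ _ _ _ z n → FormEquiv-forth (predecessor i z)
      ; back  = λ i _ _ _ _ z n′ r′ →
                  let n , r , eq′ = FormEquiv-forth (FormEquiv-sym (predecessor i z)) r′
                  in n , r , FormEquiv-sym eq′
      ; bind  = λ h i _ _ _ _ z → FormEquiv-bind (predecessor i z) h
      ; exf   = λ h i _ _ _ _ z → FormEquiv-exf (predecessor i z) h
      ; exb   = λ h i _ _ _ _ z j n′ →
                  let n , eq′ = FormEquiv-exf (FormEquiv-sym (predecessor i z)) h j n′
                  in n , FormEquiv-sym eq′
      }

lemma5p3 : ExcludedMiddle 0ℓ →
    ∀ {nP nN : ℕ} (F : Features) (𝔐 𝔐' : Model nP nN) (ℓ k : ℕ)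
      (ms : Vec (W 𝔐) k) (m : W 𝔐) (ms' : Vec (W 𝔐') k) (m' : W 𝔐') →
      FormEquiv F k ℓ 𝔐 𝔐' ms m ms' m' ⇔ BisimCond F k ℓ 𝔐 𝔐' ms m ms' m'
lemma5p3 em {nP} {nN} F 𝔐 𝔐' ℓ k ms m ms' m' = mk⇔
  (Characteristic.equiv⇒bisim em nP nN F k ℓ)
  (λ (Z , isBisim , z₀ , _) φ p → Soundness.bisim⇒equiv isBisim fzero φ p z₀)
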